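{- Let $c_1,c_2\in C$ be PIMP computations, $\rho$ an environment and $m$ a memory. If $\sigma$ is an execution of the concrete configuration $\langle c_1\parallel c_2\rangle_k\langle\rho\rangle_{env}\langle m\rangle_{mem}$ and $\sigma$ is terminable, then $\sigma$ can be broken down into two terminable executions $\sigma_1,\sigma_2$, which are executions of the concrete configurations $\langle c_1\rangle_k\langle\rho\rangle_{env}\langle m\rangle_{mem}$ and $\langle c_2\rangle_k\langle\rho\rangle_{env}\langle m\rangle_{mem}$ respectively.
   Context: PIMP syntax. Arithmetic expressions $E::=0\mid1\mid2\mid\cdots\mid Var\mid -E\mid E_1+E_2\mid E_1-E_2\mid E_1*E_2\mid E_1\div E_2\mid E_1\bmod E_2$; boolean expressions $B::=true\mid false\mid E_1=E_2\mid E_1\neq E_2\mid E_1<E_2\mid E_1>E_2$. Atomic-block computations $CC::= Var:=E\mid if\,(B)\,CC_1\,else\,CC_2\mid CC_1;CC_2\mid Var:=Array(e_1,\dots,e_n)\mid Var[E_1]:=E_2\mid Var_1:=Var_2[E]\mid skip$. Computations $C::= Var:=E\mid if\,(B)\,C_1\,else\,C_2\mid C_1;C_2\mid while\;B\;do\;C\mid C_1\parallel C_2\mid await\;B\;then\;CC\mid skip\mid Var:=Array(e_1,\dots,e_n)\mid Var[E_1]:=E_2\mid Var_1:=Var_2[E]$. There is an empty computation $\cdot$ with $\cdot\,;c=c$ and $\cdot\parallel c=c=c\parallel\cdot$. A configuration is $\langle c\rangle_k\langle\rho\rangle_{env}\langle m\rangle_{mem}$ where $\rho$ is a finite partial map from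 program variables to integers and $m$ a finite partial map from positive naturals to integers; $\rho(e)$, $\rho(b)$ denote evaluation of expressions in $\rho$ (with the integer/boolean operations). Concrete configurations are ground such terms; a configuration is final if its computation is $\cdot$ (or an integer value). Transitions are labelled $P$ (program step) or $E$ (environment step), generated by the rules (writing $\langle c\rangle\langle\rho\rangle\langle m\rangle$ for $\langle c\rangle_k\langle\rho\rangle_{env}\langle m\rangle_{mem}$): SKIP $\langle skip\rangle\langle\rho\rangle\langle m\rangle\xrightarrow{P}\langle\cdot\rangle\langle\rho\rangle\langle m\rangle$; SEQ: if $\langle c_1\rangle\langle\rho\rangle\langle m\rangle\xrightarrow{P}\langle c_1'\rangle\langle\rho'\rangle\langle m'\rangle$ then $\langle c_1;c_2\rangle\langle\rho\rangle\langle m\rangle\xrightarrow{P}\langle c_1';c_2\rangle\langle\rho'\rangle\langle m'\rangle$; ASGN1 $\langle x:=e\rangle\langle\rho\rangle\langle m\rangle\xrightarrow{P}\langle\cdot\rangle\langle\rho[\rho(e)/x]\rangle\langle m\rangle$; ASGN2 $\langle x:=A[e]\rangle\langle\rho\rangle\langle m\rangle\xrightarrow{P}\langle\cdot\rangle\langle\rho[m(\rho(A)+\rho(e))/x]\rangle\langle m\rangle$; ASGN3 $\langle A[e_1]:=e_2\rangle\langle\rho\rangle\langle m\rangle\xrightarrow{P}\langle\cdot\rangle\langle\rho\rangle\langle m[\rho(e_2)/(\rho(A)+\rho(e_1))]\rangle$; ARRAY $\langle A:=Array(e_1,\dots,e_n)\rangle\langle\rho\rangle\langle m\rangle\xrightarrow{P}\langle\cdot\rangle\langle\rho[p/A]\rangle\langle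 p\mapsto\rho(e_1),\dots,p+n-1\mapsto\rho(e_n),m\rangle$ for any positive integer $p$ making this a well-formed map; IF1/IF2: $\langle if\,(b)\,c_1\,else\,c_2\rangle\langle\rho\rangle\langle m\rangle\xrightarrow{P}\langle c_1\rangle\langle\rho\rangle\langle m\rangle$ if $\rho(b)$ is true, resp. $\to\langle c_2\rangle\langle\rho\rangle\langle m\rangle$ if false; WHILE1/WHILE2: $\langle while\;b\;do\;c\rangle\langle\rho\rangle\langle m\rangle\xrightarrow{P}\langle c;while\;b\;do\;c\rangle\langle\rho\rangle\langle m\rangle$ if $\rho(b)$ true, resp. $\to\langle\cdot\rangle\langle\rho\rangle\langle m\rangle$ if false; AWAIT: if $\rho(b)$ is true and $\langle cc\rangle\langle\rho\rangle\langle m\rangle\xrightarrow{P}^*\langle\cdot\rangle\langle\rho'\rangle\langle m'\rangle$ then $\langle await\;b\;then\;cc\rangle\langle\rho\rangle\langle m\rangle\xrightarrow{P}\langle\cdot\rangle\langle\rho'\rangle\langle m'\rangle$; PAR1/PAR2: if $\langle c_1\rangle\langle\rho\rangle\langle m\rangle\xrightarrow{P}\langle c_1'\rangle\langle\rho'\rangle\langle m'\rangle$ then $\langle c_1\parallel c_2\rangle\langle\rho\rangle\langle m\rangle\xrightarrow{P}\langle c_1'\parallel c_2\rangle\langle\rho'\rangle\langle m'\rangle$, and symmetrically for a step of $c_2$; ENV: $\langle c\rangle\langle\rho\rangle\langle m\rangle\xrightarrow{E}\langle c\rangle\langle\rho'\rangle\langle m'\rangle$ for arbitrary $\rho',m'$.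 An execution of a concrete configuration $\gamma_0$ is a finite or infinite sequence $\gamma_0\xrightarrow{L}\gamma_1\xrightarrow{L}\cdots$ with each step labelled $L\in\{P,E\}$ and derivable by the rules. It is terminable if it is finite and from some index on all configurations are final. "$\sigma$ can be broken down into $\sigma_1,\sigma_2$" means: if $\sigma=\gamma_0\to\cdots\to\gamma_n$ with $\gamma_i=\langle c_{1i}\parallel c_{2i}\rangle\langle\rho_i\rangle\langle m_i\rangle$, then $\sigma_j$ ($j=1,2$) is the sequence $\langle c_{j0}\rangle\langle\rho_0\rangle\langle m_0\rangle\to\cdots\to\langle c_{jn}\rangle\langle\rho_n\rangle\langle m_n\rangle$ (same environments and memories, same length), where a $P$-step of $\sigma$ performed by component $j$ is a $P$-step of $\sigma_j$ and an $E$-step of the other component, and an $E$-step of $\sigma$ is an $E$-step of both. -}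

module Defs where

open import Data.Nat as ℕ using (ℕ; zero; suc; _≤_; _<_)
open import Data.Nat.Properties using () renaming (_≟_ to _≟ℕ_)
open import Data.Integer as ℤ using (ℤ; +_; -[1+_]; +[1+_])
open import Data.Integer.Properties using () renaming (_≟_ to _≟ℤ_; _<?_ to _<ℤ?_)
open import Data.Bool using (Bool; true; false; if_then_else_)
open import Data.Maybe using (Maybe; just; nothing; _>>=_)
open import Data.List using (List; []; _∷_; length)
open import Data.Product using (Σ; ∃; _×_; _,_)
open import Data.Sum using (_⊎_)
open import Relation.Nullary using (does)
open import Relation.Binary.PropositionalEquality using (_≡_)
open import Relation.Binary.Construct.Closure.ReflexiveTransitive using (Star)

Var : Set
Var = ℕ

data Exp : Set where
  num   : ℕ → Exp
  var   : Var → Exp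
  neg   : Exp → Exp
  _⊕_   : Exp → Exp → Exp
  _⊖_   : Exp → Exp → Exp
  _⊗_   : Exp → Exp → Exp
  _⊘_   : Exp → Exp → Exp
  _mod_ : Exp → Exp → Exp

data BExp : Set where
  btrue bfalse : BExp
  _=ᵇ_ _≠ᵇ_ _<ᵇ_ _>ᵇ_ : Exp → Exp → BExp

data AComp : Set where
  assignA : Var → Exp → AComp
  ifA     : BExp → AComp → AComp → AComp
  seqA    : AComp → AComp → AComp
  arrayA  : Var → List Exp → AComp
  storeA  : Var → Exp → Exp → AComp
  loadA   : Var → Var → Exp → AComp
  skipA   : AComp

data Comp : Set where
  done   : Comp                               -- the empty computation ·
  assign : Var → Exp → Comp
  ifc_then_else_ : BExp → Comp → Comp → Comp
  _⨾_    : Comp → Comp → Comp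
  while_loop_ : BExp → Comp → Comp
  _∥_    : Comp → Comp → Comp
  await_then_ : BExp → AComp → Comp
  skip   : Comp
  array  : Var → List Exp → Comp
  store  : Var → Exp → Exp → Comp
  load   : Var → Var → Exp → Comp

embed : AComp → Comp
embed (assignA x e) = assign x e
embed (ifA b c₁ c₂) = ifc b then embed c₁ else embed c₂
embed (seqA c₁ c₂) = embed c₁ ⨾ embed c₂
embed (arrayA x es) = array x es
embed (storeA a e₁ e₂) = store a e₁ e₂
embed (loadA x a e) = load x a e
embed skipA = skip

-- c is a computation of the grammar C (contains no occurrence of ·)
data InC : Comp → Set where
  assign : ∀ {x e} → InC (assign x e)
  ite    : ∀ {b c₁ c₂} → InC c₁ → InC c₂ → InC (ifc b then c₁ else c₂)
  seq    : ∀ {c₁ c₂} → InC c₁ → InC c₂ → InC (c₁ ⨾ c₂)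
  while  : ∀ {b c} → InC c → InC (while b loop c)
  par    : ∀ {c₁ c₂} → InC c₁ → InC c₂ → InC (c₁ ∥ c₂)
  await  : ∀ {b cc} → InC (await b then cc)
  skip   : InC skip
  array  : ∀ {x es} → InC (array x es)
  store  : ∀ {a e₁ e₂} → InC (store a e₁ e₂)
  load   : ∀ {x a e} → InC (load x a e)

-- the structural identities  · ; c = c  and  · ∥ c = c = c ∥ ·
_⨾′_ : Comp → Comp → Comp
done ⨾′ c = c
c₁   ⨾′ c = c₁ ⨾ c

_∥′_ : Comp → Comp → Comp
done ∥′ c = c
c₁ ∥′ done = c₁
c₁ ∥′ c₂ = c₁ ∥ c₂

Env : Set
Env = Var → Maybe ℤ

-- memory: address n (a positive natural) ↦ value; key 0 is never used
Mem : Set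
Mem = ℕ → Maybe ℤ

FiniteEnv : Env → Set
FiniteEnv ρ = ∃ λ N → ∀ x → N ≤ x → ρ x ≡ nothing

FiniteMem : Mem → Set
FiniteMem m = (m 0 ≡ nothing) × (∃ λ N → ∀ a → N ≤ a → m a ≡ nothing)

updEnv : Env → Var → ℤ → Env
updEnv ρ x v y = if does (y ≟ℕ x) then just v else ρ y

updMem : Mem → ℕ → ℤ → Mem
updMem m a v b = if does (b ≟ℕ a) then just v else m b

toAddr : ℤ → Maybe ℕ
toAddr +[1+ n ] = just (suc n)
toAddr _ = nothing

divZ : ℤ → ℤ → Maybe ℤ
divZ i (+ zero) = nothing
divZ i +[1+ n ] = just (i ℤ./ +[1+ n ])
divZ i -[1+ n ] = just (i ℤ./ -[1+ n ])

modZ : ℤ → ℤ → Maybe ℤ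
modZ i (+ zero) = nothing
modZ i +[1+ n ] = just (+ (i ℤ.% +[1+ n ]))
modZ i -[1+ n ] = just (+ (i ℤ.% -[1+ n ]))

bin : (ℤ → ℤ → Maybe ℤ) → Maybe ℤ → Maybe ℤ → Maybe ℤ
bin f a b = a >>= λ i → b >>= λ j → f i j

evalE : Env → Exp → Maybe ℤ
evalE ρ (num n) = just (+ n)
evalE ρ (var x) = ρ x
evalE ρ (neg e) = evalE ρ e >>= λ i → just (ℤ.- i)
evalE ρ (e₁ ⊕ e₂) = bin (λ i j → just (i ℤ.+ j)) (evalE ρ e₁) (evalE ρ e₂)
evalE ρ (e₁ ⊖ e₂) = bin (λ i j → just (i ℤ.- j)) (evalE ρ e₁) (evalE ρ e₂)
evalE ρ (e₁ ⊗ e₂) = bin (λ i j → just (i ℤ.* j)) (evalE ρ e₁) (evalE ρ e₂)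
evalE ρ (e₁ ⊘ e₂) = bin divZ (evalE ρ e₁) (evalE ρ e₂)
evalE ρ (e₁ mod e₂) = bin modZ (evalE ρ e₁) (evalE ρ e₂)

cmp : (ℤ → ℤ → Bool) → Maybe ℤ → Maybe ℤ → Maybe Bool
cmp f a b = a >>= λ i → b >>= λ j → just (f i j)

evalB : Env → BExp → Maybe Bool
evalB ρ btrue = just true
evalB ρ bfalse = just false
evalB ρ (e₁ =ᵇ e₂) = cmp (λ i j → does (i ≟ℤ j)) (evalE ρ e₁) (evalE ρ e₂)
evalB ρ (e₁ ≠ᵇ e₂) = cmp (λ i j → if does (i ≟ℤ j) then false else true) (evalE ρ e₁) (evalE ρ e₂)
evalB ρ (e₁ <ᵇ e₂) = cmp (λ i j → does (i <ℤ? j)) (evalE ρ e₁) (evalE ρ e₂)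
evalB ρ (e₁ >ᵇ e₂) = cmp (λ i j → does (j <ℤ? i)) (evalE ρ e₁) (evalE ρ e₂)

evalEs : Env → List Exp → Maybe (List ℤ)
evalEs ρ [] = just []
evalEs ρ (e ∷ es) = evalE ρ e >>= λ v → evalEs ρ es >>= λ vs → just (v ∷ vs)

allocate : Mem → ℕ → List ℤ → Mem
allocate m p [] = m
allocate m p (v ∷ vs) = updMem (allocate m (suc p) vs) p v

-- the addresses p, …, p+n-1 are all fresh in m (well-formed disjoint union)
Fresh : Mem → ℕ → ℕ → Set
Fresh m p n = ∀ i → i < n → m (p ℕ.+ i) ≡ nothing

record Config : Set where
  constructor ⟨_⟩⟨_⟩⟨_⟩
  field
    k   : Comp
    env : Env
    mem : Mem
open Config public

Final : Config → Set
Final γ = k γ ≡ done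

data Label : Set where
  P E : Label

data PStep : Config → Config → Set where
  SKIP  : ∀ {ρ m} → PStep ⟨ skip ⟩⟨ ρ ⟩⟨ m ⟩ ⟨ done ⟩⟨ ρ ⟩⟨ m ⟩
  SEQ   : ∀ {c₁ c₂ c₁' ρ ρ' m m'} →
          PStep ⟨ c₁ ⟩⟨ ρ ⟩⟨ m ⟩ ⟨ c₁' ⟩⟨ ρ' ⟩⟨ m' ⟩ →
          PStep ⟨ c₁ ⨾ c₂ ⟩⟨ ρ ⟩⟨ m ⟩ ⟨ c₁' ⨾′ c₂ ⟩⟨ ρ' ⟩⟨ m' ⟩
  ASGN1 : ∀ {x e v ρ m} → evalE ρ e ≡ just v →
          PStep ⟨ assign x e ⟩⟨ ρ ⟩⟨ m ⟩ ⟨ done ⟩⟨ updEnv ρ x v ⟩⟨ m ⟩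
  ASGN2 : ∀ {x A e pa i a v ρ m} →
          ρ A ≡ just pa → evalE ρ e ≡ just i → toAddr (pa ℤ.+ i) ≡ just a → m a ≡ just v →
          PStep ⟨ load x A e ⟩⟨ ρ ⟩⟨ m ⟩ ⟨ done ⟩⟨ updEnv ρ x v ⟩⟨ m ⟩
  ASGN3 : ∀ {A e₁ e₂ pa i a v ρ m} →
          ρ A ≡ just pa → evalE ρ e₁ ≡ just i → toAddr (pa ℤ.+ i) ≡ just a →
          evalE ρ e₂ ≡ just v →
          PStep ⟨ store A e₁ e₂ ⟩⟨ ρ ⟩⟨ m ⟩ ⟨ done ⟩⟨ ρ ⟩⟨ updMem m a v ⟩
  ARRAY : ∀ {A es vs p ρ m} → evalEs ρ es ≡ just vs →
          Fresh m (suc p) (length vs) →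
          PStep ⟨ array A es ⟩⟨ ρ ⟩⟨ m ⟩
                ⟨ done ⟩⟨ updEnv ρ A (+ suc p) ⟩⟨ allocate m (suc p) vs ⟩
  IF1   : ∀ {b c₁ c₂ ρ m} → evalB ρ b ≡ just true →
          PStep ⟨ ifc b then c₁ else c₂ ⟩⟨ ρ ⟩⟨ m ⟩ ⟨ c₁ ⟩⟨ ρ ⟩⟨ m ⟩
  IF2   : ∀ {b c₁ c₂ ρ m} → evalB ρ b ≡ just false →
          PStep ⟨ ifc b then c₁ else c₂ ⟩⟨ ρ ⟩⟨ m ⟩ ⟨ c₂ ⟩⟨ ρ ⟩⟨ m ⟩
  WHILE1 : ∀ {b c ρ m} → evalB ρ b ≡ just true →
          PStep ⟨ while b loop c ⟩⟨ ρ ⟩⟨ m ⟩ ⟨ c ⨾′ (while b loop c) ⟩⟨ ρ ⟩⟨ m ⟩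
  WHILE2 : ∀ {b c ρ m} → evalB ρ b ≡ just false →
          PStep ⟨ while b loop c ⟩⟨ ρ ⟩⟨ m ⟩ ⟨ done ⟩⟨ ρ ⟩⟨ m ⟩
  AWAIT : ∀ {b cc ρ ρ' m m'} → evalB ρ b ≡ just true →
          Star PStep ⟨ embed cc ⟩⟨ ρ ⟩⟨ m ⟩ ⟨ done ⟩⟨ ρ' ⟩⟨ m' ⟩ →
          PStep ⟨ await b then cc ⟩⟨ ρ ⟩⟨ m ⟩ ⟨ done ⟩⟨ ρ' ⟩⟨ m' ⟩
  PAR1  : ∀ {c₁ c₂ c₁' ρ ρ' m m'} →
          PStep ⟨ c₁ ⟩⟨ ρ ⟩⟨ m ⟩ ⟨ c₁' ⟩⟨ ρ' ⟩⟨ m' ⟩ →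
          PStep ⟨ c₁ ∥ c₂ ⟩⟨ ρ ⟩⟨ m ⟩ ⟨ c₁' ∥′ c₂ ⟩⟨ ρ' ⟩⟨ m' ⟩
  PAR2  : ∀ {c₁ c₂ c₂' ρ ρ' m m'} →
          PStep ⟨ c₂ ⟩⟨ ρ ⟩⟨ m ⟩ ⟨ c₂' ⟩⟨ ρ' ⟩⟨ m' ⟩ →
          PStep ⟨ c₁ ∥ c₂ ⟩⟨ ρ ⟩⟨ m ⟩ ⟨ c₁ ∥′ c₂' ⟩⟨ ρ' ⟩⟨ m' ⟩

data Step : Label → Config → Config → Set where
  prog : ∀ {γ γ'} → PStep γ γ' → Step P γ γ'
  ENV  : ∀ {c ρ ρ' m m'} → FiniteEnv ρ' → FiniteMem m' →
         Step E ⟨ c ⟩⟨ ρ ⟩⟨ m ⟩ ⟨ c ⟩⟨ ρ' ⟩⟨ m' ⟩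

-- Finite executions  γ₀ —L₀→ γ₁ —L₁→ … —→ γ_len
-- (only conf i for i ≤ len and lab i for i < len are meaningful)

record Execution : Set where
  field
    len  : ℕ
    conf : ℕ → Config
    lab  : ℕ → Label
    step : ∀ i → i < len → Step (lab i) (conf i) (conf (suc i))
open Execution public

ExecutionOf : Execution → Config → Set
ExecutionOf σ γ₀ = conf σ 0 ≡ γ₀

Terminable : Execution → Set
Terminable σ = ∃ λ j → j ≤ len σ × (∀ i → j ≤ i → i ≤ len σ → Final (conf σ i))

BrokenDown : Execution → Execution → Execution → Set
BrokenDown σ σ₁ σ₂ =
  len σ₁ ≡ len σ × len σ₂ ≡ len σ ×
  (∀ i → i ≤ len σ →
     k (conf σ i) ≡ (k (conf σ₁ i) ∥′ k (conf σ₂ i)) ×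
     env (conf σ₁ i) ≡ env (conf σ i) × mem (conf σ₁ i) ≡ mem (conf σ i) ×
     env (conf σ₂ i) ≡ env (conf σ i) × mem (conf σ₂ i) ≡ mem (conf σ i)) ×
  (∀ i → i < len σ →
     (lab σ i ≡ E → lab σ₁ i ≡ E × lab σ₂ i ≡ E) ×
     (lab σ i ≡ P → (lab σ₁ i ≡ P × lab σ₂ i ≡ E) ⊎ (lab σ₁ i ≡ E × lab σ₂ i ≡ P)))

{-# OPTIONS --safe #-}
-- Follow σ step by step, maintaining a split of its computation as a ∥′ b.  A program
-- step of σ is a program step of exactly one component: by inversion of PAR1/PAR2, or
-- directly once the other component has finished.  The other component sees the same
-- change of state as an environment step, which is legal because program steps keep
-- environment and memory finite.  Once σ's computation is ·, so are both components,
-- since a ∥′ b = · forces a = b = ·.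
module Submission where

open import Defs
open import Data.Product using (Σ; ∃; _×_; _,_; proj₁; proj₂)
open import Data.Nat using (ℕ; zero; suc; _≤_; _<_; _⊔_; _<?_)
open import Data.Nat.Properties
  using (m⊔n≤o⇒m≤o; m⊔n≤o⇒n≤o; >⇒≢; <⇒≤) renaming (_≟_ to _≟ℕ_)
open import Data.Integer as ℤ using (+_; +[1+_])
open import Data.Sum using (_⊎_; inj₁; inj₂)
open import Data.Empty using (⊥-elim)
open import Data.List using ([]; _∷_)
open import Data.Maybe using (just; nothing)
open import Relation.Nullary using (Dec; yes; no)
open import Relation.Nullary.Decidable using (dec-false)
open import Relation.Binary.PropositionalEquality using (_≡_; _≢_; refl; sym; trans; cong; subst)
open import Relation.Binary.Construct.Closure.ReflexiveTransitive using (Star; ε; _◅_)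

done? : (c : Comp) → Dec (c ≡ done)
done? done = yes refl
done? (assign _ _) = no λ ()
done? (ifc _ then _ else _) = no λ ()
done? (_ ⨾ _) = no λ ()
done? (while _ loop _) = no λ ()
done? (_ ∥ _) = no λ ()
done? (await _ then _) = no λ ()
done? skip = no λ ()
done? (array _ _) = no λ ()
done? (store _ _ _) = no λ ()
done? (load _ _ _) = no λ ()

InC⇒≢done : ∀ {c} → InC c → c ≢ done
InC⇒≢done () refl

∥′-identityʳ : ∀ c → c ∥′ done ≡ c
∥′-identityʳ done = refl
∥′-identityʳ (assign _ _) = refl
∥′-identityʳ (ifc _ then _ else _) = refl
∥′-identityʳ (_ ⨾ _) = refl
∥′-identityʳ (while _ loop _) = refl
∥′-identityʳ (_ ∥ _) = refl
∥′-identityʳ (await _ then _) = refl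
∥′-identityʳ skip = refl
∥′-identityʳ (array _ _) = refl
∥′-identityʳ (store _ _ _) = refl
∥′-identityʳ (load _ _ _) = refl

-- a ∥′ b only reduces once the heads of both a and b are known.
∥′-≡-∥ : ∀ {a b} → a ≢ done → b ≢ done → a ∥′ b ≡ a ∥ b
∥′-≡-∥ {done} a≢done _ = ⊥-elim (a≢done refl)
∥′-≡-∥ {b = done} _ b≢done = ⊥-elim (b≢done refl)
∥′-≡-∥ {assign _ _} {assign _ _} _ _ = refl
∥′-≡-∥ {assign _ _} {ifc _ then _ else _} _ _ = refl
∥′-≡-∥ {assign _ _} {_ ⨾ _} _ _ = refl
∥′-≡-∥ {assign _ _} {while _ loop _} _ _ = refl
∥′-≡-∥ {assign _ _} {_ ∥ _} _ _ = refl
∥′-≡-∥ {assign _ _} {await _ then _} _ _ = refl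
∥′-≡-∥ {assign _ _} {skip} _ _ = refl
∥′-≡-∥ {assign _ _} {array _ _} _ _ = refl
∥′-≡-∥ {assign _ _} {store _ _ _} _ _ = refl
∥′-≡-∥ {assign _ _} {load _ _ _} _ _ = refl
∥′-≡-∥ {ifc _ then _ else _} {assign _ _} _ _ = refl
∥′-≡-∥ {ifc _ then _ else _} {ifc _ then _ else _} _ _ = refl
∥′-≡-∥ {ifc _ then _ else _} {_ ⨾ _} _ _ = refl
∥′-≡-∥ {ifc _ then _ else _} {while _ loop _} _ _ = refl
∥′-≡-∥ {ifc _ then _ else _} {_ ∥ _} _ _ = refl
∥′-≡-∥ {ifc _ then _ else _} {await _ then _} _ _ = refl
∥′-≡-∥ {ifc _ then _ else _} {skip} _ _ = refl
∥′-≡-∥ {ifc _ then _ else _} {array _ _} _ _ = refl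
∥′-≡-∥ {ifc _ then _ else _} {store _ _ _} _ _ = refl
∥′-≡-∥ {ifc _ then _ else _} {load _ _ _} _ _ = refl
∥′-≡-∥ {_ ⨾ _} {assign _ _} _ _ = refl
∥′-≡-∥ {_ ⨾ _} {ifc _ then _ else _} _ _ = refl
∥′-≡-∥ {_ ⨾ _} {_ ⨾ _} _ _ = refl
∥′-≡-∥ {_ ⨾ _} {while _ loop _} _ _ = refl
∥′-≡-∥ {_ ⨾ _} {_ ∥ _} _ _ = refl
∥′-≡-∥ {_ ⨾ _} {await _ then _} _ _ = refl
∥′-≡-∥ {_ ⨾ _} {skip} _ _ = refl
∥′-≡-∥ {_ ⨾ _} {array _ _} _ _ = refl
∥′-≡-∥ {_ ⨾ _} {store _ _ _} _ _ = refl
∥′-≡-∥ {_ ⨾ _} {load _ _ _} _ _ = refl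
∥′-≡-∥ {while _ loop _} {assign _ _} _ _ = refl
∥′-≡-∥ {while _ loop _} {ifc _ then _ else _} _ _ = refl
∥′-≡-∥ {while _ loop _} {_ ⨾ _} _ _ = refl
∥′-≡-∥ {while _ loop _} {while _ loop _} _ _ = refl
∥′-≡-∥ {while _ loop _} {_ ∥ _} _ _ = refl
∥′-≡-∥ {while _ loop _} {await _ then _} _ _ = refl
∥′-≡-∥ {while _ loop _} {skip} _ _ = refl
∥′-≡-∥ {while _ loop _} {array _ _} _ _ = refl
∥′-≡-∥ {while _ loop _} {store _ _ _} _ _ = refl
∥′-≡-∥ {while _ loop _} {load _ _ _} _ _ = refl
∥′-≡-∥ {_ ∥ _} {assign _ _} _ _ = refl
∥′-≡-∥ {_ ∥ _} {ifc _ then _ else _} _ _ = refl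
∥′-≡-∥ {_ ∥ _} {_ ⨾ _} _ _ = refl
∥′-≡-∥ {_ ∥ _} {while _ loop _} _ _ = refl
∥′-≡-∥ {_ ∥ _} {_ ∥ _} _ _ = refl
∥′-≡-∥ {_ ∥ _} {await _ then _} _ _ = refl
∥′-≡-∥ {_ ∥ _} {skip} _ _ = refl
∥′-≡-∥ {_ ∥ _} {array _ _} _ _ = refl
∥′-≡-∥ {_ ∥ _} {store _ _ _} _ _ = refl
∥′-≡-∥ {_ ∥ _} {load _ _ _} _ _ = refl
∥′-≡-∥ {await _ then _} {assign _ _} _ _ = refl
∥′-≡-∥ {await _ then _} {ifc _ then _ else _} _ _ = refl
∥′-≡-∥ {await _ then _} {_ ⨾ _} _ _ = refl
∥′-≡-∥ {await _ then _} {while _ loop _} _ _ = refl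
∥′-≡-∥ {await _ then _} {_ ∥ _} _ _ = refl
∥′-≡-∥ {await _ then _} {await _ then _} _ _ = refl
∥′-≡-∥ {await _ then _} {skip} _ _ = refl
∥′-≡-∥ {await _ then _} {array _ _} _ _ = refl
∥′-≡-∥ {await _ then _} {store _ _ _} _ _ = refl
∥′-≡-∥ {await _ then _} {load _ _ _} _ _ = refl
∥′-≡-∥ {skip} {assign _ _} _ _ = refl
∥′-≡-∥ {skip} {ifc _ then _ else _} _ _ = refl
∥′-≡-∥ {skip} {_ ⨾ _} _ _ = refl
∥′-≡-∥ {skip} {while _ loop _} _ _ = refl
∥′-≡-∥ {skip} {_ ∥ _} _ _ = refl
∥′-≡-∥ {skip} {await _ then _} _ _ = refl
∥′-≡-∥ {skip} {skip} _ _ = refl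
∥′-≡-∥ {skip} {array _ _} _ _ = refl
∥′-≡-∥ {skip} {store _ _ _} _ _ = refl
∥′-≡-∥ {skip} {load _ _ _} _ _ = refl
∥′-≡-∥ {array _ _} {assign _ _} _ _ = refl
∥′-≡-∥ {array _ _} {ifc _ then _ else _} _ _ = refl
∥′-≡-∥ {array _ _} {_ ⨾ _} _ _ = refl
∥′-≡-∥ {array _ _} {while _ loop _} _ _ = refl
∥′-≡-∥ {array _ _} {_ ∥ _} _ _ = refl
∥′-≡-∥ {array _ _} {await _ then _} _ _ = refl
∥′-≡-∥ {array _ _} {skip} _ _ = refl
∥′-≡-∥ {array _ _} {array _ _} _ _ = refl
∥′-≡-∥ {array _ _} {store _ _ _} _ _ = refl
∥′-≡-∥ {array _ _} {load _ _ _} _ _ = refl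
∥′-≡-∥ {store _ _ _} {assign _ _} _ _ = refl
∥′-≡-∥ {store _ _ _} {ifc _ then _ else _} _ _ = refl
∥′-≡-∥ {store _ _ _} {_ ⨾ _} _ _ = refl
∥′-≡-∥ {store _ _ _} {while _ loop _} _ _ = refl
∥′-≡-∥ {store _ _ _} {_ ∥ _} _ _ = refl
∥′-≡-∥ {store _ _ _} {await _ then _} _ _ = refl
∥′-≡-∥ {store _ _ _} {skip} _ _ = refl
∥′-≡-∥ {store _ _ _} {array _ _} _ _ = refl
∥′-≡-∥ {store _ _ _} {store _ _ _} _ _ = refl
∥′-≡-∥ {store _ _ _} {load _ _ _} _ _ = refl
∥′-≡-∥ {load _ _ _} {assign _ _} _ _ = refl
∥′-≡-∥ {load _ _ _} {ifc _ then _ else _} _ _ = refl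
∥′-≡-∥ {load _ _ _} {_ ⨾ _} _ _ = refl
∥′-≡-∥ {load _ _ _} {while _ loop _} _ _ = refl
∥′-≡-∥ {load _ _ _} {_ ∥ _} _ _ = refl
∥′-≡-∥ {load _ _ _} {await _ then _} _ _ = refl
∥′-≡-∥ {load _ _ _} {skip} _ _ = refl
∥′-≡-∥ {load _ _ _} {array _ _} _ _ = refl
∥′-≡-∥ {load _ _ _} {store _ _ _} _ _ = refl
∥′-≡-∥ {load _ _ _} {load _ _ _} _ _ = refl

∥′-conical : ∀ a b → a ∥′ b ≡ done → a ≡ done × b ≡ done
∥′-conical a b a∥′b≡done with done? a | done? b
... | yes refl | _ = refl , a∥′b≡done
... | no a≢done | yes refl = ⊥-elim (a≢done (trans (sym (∥′-identityʳ a)) a∥′b≡done))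
... | no a≢done | no b≢done with trans (sym (∥′-≡-∥ a≢done b≢done)) a∥′b≡done
...   | ()

FiniteConfig : Config → Set
FiniteConfig γ = FiniteEnv (env γ) × FiniteMem (mem γ)

-- Env and Mem coincide, so this also serves memory updates.
updEnv-finite : ∀ {ρ} x v → FiniteEnv ρ → FiniteEnv (updEnv ρ x v)
updEnv-finite {ρ} x v (N , beyondN) = N ⊔ suc x , beyond
  where
  beyond : ∀ y → N ⊔ suc x ≤ y → updEnv ρ x v y ≡ nothing
  beyond y N⊔x<y rewrite dec-false (y ≟ℕ x) (>⇒≢ (m⊔n≤o⇒n≤o N (suc x) N⊔x<y)) =
    beyondN y (m⊔n≤o⇒m≤o N (suc x) N⊔x<y)

updMem-finite : ∀ {m} a v → FiniteMem m → FiniteMem (updMem m (suc a) v)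
updMem-finite a v (m0≡nothing , bounded) = m0≡nothing , updEnv-finite (suc a) v bounded

allocate-finite : ∀ {m} p vs → FiniteMem m → FiniteMem (allocate m (suc p) vs)
allocate-finite p [] finite = finite
allocate-finite p (v ∷ vs) finite = updMem-finite p v (allocate-finite (suc p) vs finite)

toAddr-positive : ∀ z {a} → toAddr z ≡ just a → ∃ λ n → a ≡ suc n
toAddr-positive +[1+ n ] refl = n , refl

mutual
  PStep-finite : ∀ {γ γ'} → PStep γ γ' → FiniteConfig γ → FiniteConfig γ'
  PStep-finite SKIP finite = finite
  PStep-finite (SEQ s) finite = PStep-finite s finite
  PStep-finite (ASGN1 {x = x} {v = v} _) (ρ-fin , m-fin) = updEnv-finite x v ρ-fin , m-fin
  PStep-finite (ASGN2 {x = x} {v = v} _ _ _ _) (ρ-fin , m-fin) = updEnv-finite x v ρ-fin , m-fin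
  PStep-finite (ASGN3 {pa = pa} {i = i} {v = v} _ _ addr _) (ρ-fin , m-fin)
    with toAddr-positive (pa ℤ.+ i) addr
  ... | n , refl = ρ-fin , updMem-finite n v m-fin
  PStep-finite (ARRAY {A = A} {vs = vs} {p = p} _ _) (ρ-fin , m-fin) =
    updEnv-finite A (+ suc p) ρ-fin , allocate-finite p vs m-fin
  PStep-finite (IF1 _) finite = finite
  PStep-finite (IF2 _) finite = finite
  PStep-finite (WHILE1 _) finite = finite
  PStep-finite (WHILE2 _) finite = finite
  PStep-finite (AWAIT _ steps) finite = Star-finite steps finite
  PStep-finite (PAR1 s) finite = PStep-finite s finite
  PStep-finite (PAR2 s) finite = PStep-finite s finite

  Star-finite : ∀ {γ γ'} → Star PStep γ γ' → FiniteConfig γ → FiniteConfig γ'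
  Star-finite ε finite = finite
  Star-finite (s ◅ steps) finite = Star-finite steps (PStep-finite s finite)

Step-finite : ∀ {L γ γ'} → Step L γ γ' → FiniteConfig γ → FiniteConfig γ'
Step-finite (prog s) finite = PStep-finite s finite
Step-finite (ENV ρ'-fin m'-fin) _ = ρ'-fin , m'-fin

LabelSplit : Label → Label → Label → Set
LabelSplit L L₁ L₂ =
  (L ≡ E → L₁ ≡ E × L₂ ≡ E) × (L ≡ P → (L₁ ≡ P × L₂ ≡ E) ⊎ (L₁ ≡ E × L₂ ≡ P))

left-moves : LabelSplit P P E
left-moves = (λ ()) , λ _ → inj₁ (refl , refl)

right-moves : LabelSplit P E P
right-moves = (λ ()) , λ _ → inj₂ (refl , refl)

environment-moves : LabelSplit E E E
environment-moves = (λ _ → refl , refl) , λ ()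

record StepSplit (L : Label) (γ γ' : Config) (a b : Comp) : Set where
  field
    a' b'      : Comp
    L₁ L₂      : Label
    left-step  : Step L₁ ⟨ a ⟩⟨ env γ ⟩⟨ mem γ ⟩ ⟨ a' ⟩⟨ env γ' ⟩⟨ mem γ' ⟩
    right-step : Step L₂ ⟨ b ⟩⟨ env γ ⟩⟨ mem γ ⟩ ⟨ b' ⟩⟨ env γ' ⟩⟨ mem γ' ⟩
    splits′    : k γ' ≡ a' ∥′ b'
    labels     : LabelSplit L L₁ L₂
open StepSplit

PStep-∥-inv : ∀ {γ γ' a b} → PStep γ γ' → k γ ≡ a ∥ b →
  (∃ λ a' → PStep ⟨ a ⟩⟨ env γ ⟩⟨ mem γ ⟩ ⟨ a' ⟩⟨ env γ' ⟩⟨ mem γ' ⟩ × k γ' ≡ a' ∥′ b) ⊎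
  (∃ λ b' → PStep ⟨ b ⟩⟨ env γ ⟩⟨ mem γ ⟩ ⟨ b' ⟩⟨ env γ' ⟩⟨ mem γ' ⟩ × k γ' ≡ a ∥′ b')
PStep-∥-inv (PAR1 s) refl = inj₁ (_ , s , refl)
PStep-∥-inv (PAR2 s) refl = inj₂ (_ , s , refl)

PStep-from : ∀ {γ γ' c} → k γ ≡ c → PStep γ γ' → PStep ⟨ c ⟩⟨ env γ ⟩⟨ mem γ ⟩ γ'
PStep-from refl s = s

-- Finiteness of γ' is what makes the idle component's environment step legal.
split-step : ∀ {L γ γ'} a b → k γ ≡ a ∥′ b → FiniteConfig γ' → Step L γ γ' →
  StepSplit L γ γ' a b
split-step a b γ≡a∥′b _ (ENV ρ'-fin m'-fin) =
  record { left-step = ENV ρ'-fin m'-fin ; right-step = ENV ρ'-fin m'-fin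
         ; splits′ = γ≡a∥′b ; labels = environment-moves }
split-step {γ' = γ'} a b γ≡a∥′b (ρ'-fin , m'-fin) (prog s) with done? a | done? b
... | yes refl | _ =
  record { left-step = ENV ρ'-fin m'-fin ; right-step = prog (PStep-from γ≡a∥′b s)
         ; splits′ = refl ; labels = right-moves }
... | no _ | yes refl =
  record { left-step = prog (PStep-from (trans γ≡a∥′b (∥′-identityʳ a)) s)
         ; right-step = ENV ρ'-fin m'-fin
         ; splits′ = sym (∥′-identityʳ (k γ')) ; labels = left-moves }
... | no a≢done | no b≢done with PStep-∥-inv s (trans γ≡a∥′b (∥′-≡-∥ a≢done b≢done))
...   | inj₁ (_ , s₁ , splits) =
  record { left-step = prog s₁ ; right-step = ENV ρ'-fin m'-fin
         ; splits′ = splits ; labels = left-moves }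
...   | inj₂ (_ , s₂ , splits) =
  record { left-step = ENV ρ'-fin m'-fin ; right-step = prog s₂
         ; splits′ = splits ; labels = right-moves }

module BreakDown (σ : Execution) {a b : Comp}
                 (start-splits : k (conf σ 0) ≡ a ∥′ b)
                 (start-finite : FiniteConfig (conf σ 0)) where

  finite : ∀ i → i ≤ len σ → FiniteConfig (conf σ i)
  finite zero _ = start-finite
  finite (suc i) i<len = Step-finite (step σ i i<len) (finite i (<⇒≤ i<len))

  record Split (i : ℕ) : Set where
    field
      left right : Comp
      splits     : i ≤ len σ → k (conf σ i) ≡ left ∥′ right
  open Split

  mutual
    split : ∀ i → Split i
    split zero = record { left = a ; right = b ; splits = λ _ → start-splits }
    split (suc i) = split-next i (i <? len σ)

    split-step-at : ∀ i → i < len σ →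
      StepSplit (lab σ i) (conf σ i) (conf σ (suc i)) (left (split i)) (right (split i))
    split-step-at i i<len =
      split-step _ _ (splits (split i) (<⇒≤ i<len)) (finite (suc i) i<len) (step σ i i<len)

    -- Beyond the end of σ the split is frozen; it is never inspected there.
    split-next : ∀ i → Dec (i < len σ) → Split (suc i)
    split-next i (yes i<len) = record
      { left = a' (split-step-at i i<len) ; right = b' (split-step-at i i<len)
      ; splits = λ _ → splits′ (split-step-at i i<len) }
    split-next i (no i≮len) = record
      { left = left (split i) ; right = right (split i)
      ; splits = λ i<len → ⊥-elim (i≮len i<len) }

  left-label right-label : ∀ i → Dec (i < len σ) → Label
  left-label i (yes i<len) = L₁ (split-step-at i i<len)
  left-label i (no _) = P
  right-label i (yes i<len) = L₂ (split-step-at i i<len)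
  right-label i (no _) = P

  left-conf right-conf : ℕ → Config
  left-conf i = ⟨ left (split i) ⟩⟨ env (conf σ i) ⟩⟨ mem (conf σ i) ⟩
  right-conf i = ⟨ right (split i) ⟩⟨ env (conf σ i) ⟩⟨ mem (conf σ i) ⟩

  left-step-at : ∀ i (i<len? : Dec (i < len σ)) → i < len σ →
    Step (left-label i i<len?) (left-conf i)
         ⟨ left (split-next i i<len?) ⟩⟨ env (conf σ (suc i)) ⟩⟨ mem (conf σ (suc i)) ⟩
  left-step-at i (yes i<len) _ = left-step (split-step-at i i<len)
  left-step-at i (no i≮len) i<len = ⊥-elim (i≮len i<len)

  right-step-at : ∀ i (i<len? : Dec (i < len σ)) → i < len σ →
    Step (right-label i i<len?) (right-conf i)
         ⟨ right (split-next i i<len?) ⟩⟨ env (conf σ (suc i)) ⟩⟨ mem (conf σ (suc i)) ⟩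
  right-step-at i (yes i<len) _ = right-step (split-step-at i i<len)
  right-step-at i (no i≮len) i<len = ⊥-elim (i≮len i<len)

  labels-at : ∀ i (i<len? : Dec (i < len σ)) → i < len σ →
    LabelSplit (lab σ i) (left-label i i<len?) (right-label i i<len?)
  labels-at i (yes i<len) _ = labels (split-step-at i i<len)
  labels-at i (no i≮len) i<len = ⊥-elim (i≮len i<len)

  σ₁ σ₂ : Execution
  σ₁ = record { len = len σ ; conf = left-conf
              ; lab = λ i → left-label i (i <? len σ)
              ; step = λ i → left-step-at i (i <? len σ) }
  σ₂ = record { len = len σ ; conf = right-conf
              ; lab = λ i → right-label i (i <? len σ)
              ; step = λ i → right-step-at i (i <? len σ) }

  brokenDown : BrokenDown σ σ₁ σ₂
  brokenDown = refl , refl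
             , (λ i i≤len → splits (split i) i≤len , refl , refl , refl , refl)
             , λ i → labels-at i (i <? len σ)

  terminable : Terminable σ → Terminable σ₁ × Terminable σ₂
  terminable (j , j≤len , final) =
    (j , j≤len , λ i j≤i i≤len → proj₁ (both-final i j≤i i≤len)) ,
    (j , j≤len , λ i j≤i i≤len → proj₂ (both-final i j≤i i≤len))
    where
    both-final : ∀ i → j ≤ i → i ≤ len σ → left (split i) ≡ done × right (split i) ≡ done
    both-final i j≤i i≤len =
      ∥′-conical _ _ (trans (sym (splits (split i) i≤len)) (final i j≤i i≤len))

proposition3 : (c₁ c₂ : Comp) → InC c₁ → InC c₂ →
    (ρ : Env) (m : Mem) → FiniteEnv ρ → FiniteMem m →
    (σ : Execution) → ExecutionOf σ ⟨ c₁ ∥ c₂ ⟩⟨ ρ ⟩⟨ m ⟩ → Terminable σ →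
    Σ Execution λ σ₁ → Σ Execution λ σ₂ →
      BrokenDown σ σ₁ σ₂ ×
      ExecutionOf σ₁ ⟨ c₁ ⟩⟨ ρ ⟩⟨ m ⟩ × Terminable σ₁ ×
      ExecutionOf σ₂ ⟨ c₂ ⟩⟨ ρ ⟩⟨ m ⟩ × Terminable σ₂
proposition3 c₁ c₂ c₁∈C c₂∈C ρ m ρ-fin m-fin σ σ-start σ-terminable =
  σ₁ , σ₂ , brokenDown ,
  same-state-as-σ c₁ , proj₁ (terminable σ-terminable) ,
  same-state-as-σ c₂ , proj₂ (terminable σ-terminable)
  where
  start-splits : k (conf σ 0) ≡ c₁ ∥′ c₂
  start-splits = trans (cong k σ-start) (sym (∥′-≡-∥ (InC⇒≢done c₁∈C) (InC⇒≢done c₂∈C)))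

  open BreakDown σ {c₁} {c₂} start-splits (subst FiniteConfig (sym σ-start) (ρ-fin , m-fin))

  same-state-as-σ : ∀ c → ⟨ c ⟩⟨ env (conf σ 0) ⟩⟨ mem (conf σ 0) ⟩ ≡ ⟨ c ⟩⟨ ρ ⟩⟨ m ⟩
  same-state-as-σ c = cong (λ γ → ⟨ c ⟩⟨ env γ ⟩⟨ mem γ ⟩) σ-start
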